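{- For each $d\in\mathbb{N}=\{0,1,2,\dots\}$, let $T$ be the (complete) binary tree of height $d+1$. Then there is no connected partition $\mathcal{P}$ of $T$ such that every part has weak diameter in $T$ at most $d$ and $\mathcal{P}$ is $2$-compressing in $T$ when viewed as a $(T/\mathcal{P})$-indexed partition via the identity map, i.e. such that for all distinct parts $P,P'\in\mathcal{P}$ with $\operatorname{dist}_T(P,P')\leq 2$, $P$ and $P'$ are adjacent in $T/\mathcal{P}$.
   Context: The binary tree of height $d+1$ is the rooted tree in which every non-leaf vertex has exactly two children and every leaf is at distance exactly $d+1$ from the root. A partition $\mathcal{P}$ of a graph $G$ is a collection of pairwise disjoint subsets (parts) of $V(G)$ with union $V(G)$; it is connected if each part induces a connected subgraph of $G$. The quotient $G/\mathcal{P}$ has vertex set $\mathcal{P}$, with distinct parts adjacent iff some edge of $G$ joins them. The weak diameter in $G$ of $S\subseteq V(G)$ is the maximum of $\operatorname{dist}_G(u,v)$ over $u,v\in S$. $\operatorname{dist}_G(P,P')$ denotes the minimum distance in $G$ between a vertex of $P$ and a vertex of $P'$. -}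

module Defs where

open import Data.Nat using (ℕ; zero; suc; _≤_)
open import Data.Bool using (Bool)
open import Data.List using (List; []; _∷_; length)
open import Data.Product using (Σ; ∃; _×_; _,_; proj₁)
open import Data.Unit using (⊤)
open import Relation.Binary.PropositionalEquality using (_≡_; _≢_)
open import Data.Sum using (_⊎_)

-- Vertices of the complete binary tree of height d+1: binary words of
-- length ≤ d+1 (the root is the empty word).  A word is read from the
-- most recent step: the children of w are (false ∷ w) and (true ∷ w).
BVertex : ℕ → Set
BVertex d = Σ (List Bool) (λ w → length w ≤ suc d)

ChildOf : ∀ {d} → BVertex d → BVertex d → Set
ChildOf c p = Σ Bool (λ b → proj₁ c ≡ b ∷ proj₁ p)

Adj : ∀ {d} → BVertex d → BVertex d → Set
Adj u v = ChildOf u v ⊎ ChildOf v u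

data Walk {d : ℕ} (P : BVertex d → Set) : BVertex d → BVertex d → ℕ → Set where
  here : ∀ {u} → P u → Walk P u u zero
  step : ∀ {u v w n} → P u → Adj u v → Walk P v w n → Walk P u w (suc n)

DistLe : ∀ {d} → BVertex d → BVertex d → ℕ → Set
DistLe {d} u v k = ∃ λ n → n ≤ k × Walk {d} (λ _ → ⊤) u v n

-- A partition of V(T) is given by a labelling f : V(T) → ℕ; the parts are
-- the nonempty fibres of f.  The part containing u is {x | f x ≡ f u}.

ConnectedPartition : ∀ {d} → (BVertex d → ℕ) → Set
ConnectedPartition {d} f =
  ∀ (u v : BVertex d) → f u ≡ f v → ∃ λ n → Walk (λ x → f x ≡ f u) u v n

WeakDiamLe : ∀ {d} → (BVertex d → ℕ) → ℕ → Set
WeakDiamLe {d} f k = ∀ (u v : BVertex d) → f u ≡ f v → DistLe u v k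

PartsAdjacent : ∀ {d} → (BVertex d → ℕ) → BVertex d → BVertex d → Set
PartsAdjacent {d} f u v =
  ∃ λ (x : BVertex d) → ∃ λ (y : BVertex d) → f x ≡ f u × f y ≡ f v × Adj x y

TwoCompressing : ∀ {d} → (BVertex d → ℕ) → Set
TwoCompressing {d} f =
  ∀ (u v : BVertex d) → f u ≢ f v → DistLe u v 2 → PartsAdjacent f u v

-- If a vertex v and both of its children lay in three distinct parts, then,
-- by connectivity, the part of each child would be confined to that child's
-- subtree.  The two children are at distance 2 through v, so 2-compression
-- would force their parts to be equal or adjacent, yet the two subtrees are
-- disjoint and no edge joins them.  Hence every non-leaf vertex shares its
-- part with one of its children, and following such children from the root
-- yields a leaf in the root's part, at distance d + 1 > d from the root.
module Submission where

open import Defs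
open import Data.Nat using (ℕ; zero; suc; _+_; _≤_; _<_; z≤n; _≟_)
open import Data.Nat.Properties
  using (≤-irrelevant; ≤-refl; ≤-trans; ≤-reflexive; n≤1+n; m≤n⇒m≤1+n; 1+n≰n;
         +-suc; +-identityʳ; +-monoʳ-≤; m≢1+n+m; module ≤-Reasoning)
open import Data.Bool using (Bool; true; false)
open import Data.List using (List; []; _∷_; length; _++_)
open import Data.List.Properties using (∷-injectiveˡ; ∷-injectiveʳ; length-++)
open import Data.Product using (∃; _×_; _,_; proj₁; proj₂)
open import Data.Sum using (inj₁; inj₂)
open import Data.Unit using (tt)
open import Data.Empty using (⊥; ⊥-elim)
open import Function using (_∘_)
open import Relation.Nullary using (¬_; yes; no)
open import Relation.Binary.PropositionalEquality

++-injectiveʳ-≡length : ∀ {A : Set} (xs ys : List A) {as bs : List A} →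
  xs ++ as ≡ ys ++ bs → length as ≡ length bs → as ≡ bs
++-injectiveʳ-≡length []       []       eq _ = eq
++-injectiveʳ-≡length []       (y ∷ ys) eq ∣as∣≡∣bs∣ =
  ⊥-elim (m≢1+n+m _ (trans (sym ∣as∣≡∣bs∣) (trans (cong length eq) (cong suc (length-++ ys)))))
++-injectiveʳ-≡length (x ∷ xs) []       eq ∣as∣≡∣bs∣ =
  ⊥-elim (m≢1+n+m _ (trans ∣as∣≡∣bs∣ (trans (cong length (sym eq)) (cong suc (length-++ xs)))))
++-injectiveʳ-≡length (x ∷ xs) (y ∷ ys) eq ∣as∣≡∣bs∣ =
  ++-injectiveʳ-≡length xs ys (∷-injectiveʳ eq) ∣as∣≡∣bs∣

module _ {d : ℕ} where

  BVertex-≡ : {u v : BVertex d} → proj₁ u ≡ proj₁ v → u ≡ v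
  BVertex-≡ {_ , p} {_ , q} refl = cong (_ ,_) (≤-irrelevant p q)

  depth : BVertex d → ℕ
  depth = length ∘ proj₁

  child : Bool → (v : BVertex d) → depth v < suc d → BVertex d
  child b (w , _) p = b ∷ w , p

  Walk-source : ∀ {P : BVertex d → Set} {u w n} → Walk P u w n → P u
  Walk-source (here Pu)     = Pu
  Walk-source (step Pu _ _) = Pu

  Adj-depth : {x y : BVertex d} → Adj x y → depth y ≤ suc (depth x)
  Adj-depth (inj₁ (_ , x≡b∷y)) =
    m≤n⇒m≤1+n (≤-trans (n≤1+n _) (≤-reflexive (cong length (sym x≡b∷y))))
  Adj-depth (inj₂ (_ , y≡b∷x)) = ≤-reflexive (cong length y≡b∷x)

  Walk-depth : ∀ {P : BVertex d → Set} {u w n} → Walk P u w n → depth w ≤ n + depth u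
  Walk-depth (here _) = ≤-refl
  Walk-depth {u = u} {w} (step {v = v} {n = n} _ u~v walk) = begin
    depth w             ≤⟨ Walk-depth walk ⟩
    n + depth v         ≤⟨ +-monoʳ-≤ n (Adj-depth {u} {v} u~v) ⟩
    n + suc (depth u)   ≡⟨ +-suc n (depth u) ⟩
    suc n + depth u     ∎
    where open ≤-Reasoning

  record InSubtree (c w : BVertex d) : Set where
    constructor _,_
    field
      path       : List Bool
      w≡path++c  : proj₁ w ≡ path ++ proj₁ c

  InSubtree-refl : {c : BVertex d} → InSubtree c c
  InSubtree-refl = [] , refl

  InSubtree-child : {c w x : BVertex d} → ChildOf x w → InSubtree c w → InSubtree c x
  InSubtree-child (b , x≡b∷w) (xs , w≡xs++c) = b ∷ xs , trans x≡b∷w (cong (b ∷_) w≡xs++c)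

  InSubtree-parent : {c v w x : BVertex d} → ChildOf c v → ChildOf w x → x ≢ v →
    InSubtree c w → InSubtree c x
  InSubtree-parent (_ , c≡b∷v) (_ , w≡b′∷x) x≢v ([] , w≡c) =
    ⊥-elim (x≢v (BVertex-≡ (∷-injectiveʳ (trans (sym w≡b′∷x) (trans w≡c c≡b∷v)))))
  InSubtree-parent _ (_ , w≡b′∷x) _ (_ ∷ xs , w≡x′∷xs++c) =
    xs , ∷-injectiveʳ (trans (sym w≡b′∷x) w≡x′∷xs++c)

  -- The only way out of the subtree of c is through the parent of c.
  Walk-stays-in-subtree : ∀ {P : BVertex d → Set} {c v u w n} → ChildOf c v → ¬ P v →
    Walk P u w n → InSubtree c u → InSubtree c w
  Walk-stays-in-subtree c≺v ¬Pv (here _) u∈c = u∈c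
  Walk-stays-in-subtree c≺v ¬Pv (step _ (inj₂ u′≺u) walk) u∈c =
    Walk-stays-in-subtree c≺v ¬Pv walk (InSubtree-child u′≺u u∈c)
  Walk-stays-in-subtree {P = P} c≺v ¬Pv (step _ (inj₁ u≺u′) walk) u∈c =
    Walk-stays-in-subtree c≺v ¬Pv walk
      (InSubtree-parent c≺v u≺u′ (λ u′≡v → ¬Pv (subst P u′≡v (Walk-source walk))) u∈c)

  sibling-subtrees-disjoint : ∀ v {b₁ b₂ p₁ p₂ x} → b₁ ≢ b₂ →
    InSubtree (child b₁ v p₁) x → InSubtree (child b₂ v p₂) x → ⊥
  sibling-subtrees-disjoint _ b₁≢b₂ (xs , x≡xs++c₁) (ys , x≡ys++c₂) =
    b₁≢b₂ (∷-injectiveˡ (++-injectiveʳ-≡length xs ys (trans (sym x≡xs++c₁) x≡ys++c₂) refl))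

  sibling-subtrees-nonadjacent : ∀ v {b₁ b₂ p₁ p₂ x y} → b₁ ≢ b₂ →
    InSubtree (child b₁ v p₁) x → InSubtree (child b₂ v p₂) y → ¬ Adj x y
  sibling-subtrees-nonadjacent v b₁≢b₂ x∈c₁ y∈c₂ (inj₁ x≺y) =
    sibling-subtrees-disjoint v b₁≢b₂ x∈c₁ (InSubtree-child x≺y y∈c₂)
  sibling-subtrees-nonadjacent v b₁≢b₂ x∈c₁ y∈c₂ (inj₂ y≺x) =
    sibling-subtrees-disjoint v b₁≢b₂ (InSubtree-child y≺x x∈c₁) y∈c₂

  siblings-at-distance-2 : ∀ v p → DistLe (child false v p) (child true v p) 2
  siblings-at-distance-2 v p =
    2 , ≤-refl , step {v = v} tt (inj₁ (false , refl)) (step tt (inj₂ (true , refl)) (here tt))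

  root : BVertex d
  root = [] , z≤n

  module _ {f : BVertex d → ℕ} (connected : ConnectedPartition f) where

    part-in-subtree : ∀ {c v x} → ChildOf c v → f c ≢ f v → f x ≡ f c → InSubtree c x
    part-in-subtree {c} {x = x} c≺v fc≢fv fx≡fc =
      Walk-stays-in-subtree c≺v (fc≢fv ∘ sym) (proj₂ (connected c x (sym fx≡fc))) InSubtree-refl

    children-not-both-split-off : TwoCompressing f → ∀ v p →
      f (child false v p) ≢ f v → f (child true v p) ≢ f v → ⊥
    children-not-both-split-off compressing v p f₀≢fv f₁≢fv
      with f (child false v p) ≟ f (child true v p)
    ... | yes f₀≡f₁ =
      sibling-subtrees-disjoint v (λ ()) InSubtree-refl (part-in-subtree (true , refl) f₁≢fv f₀≡f₁)
    ... | no f₀≢f₁ with compressing _ _ f₀≢f₁ (siblings-at-distance-2 v p)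
    ... | x , y , fx≡f₀ , fy≡f₁ , x~y =
      sibling-subtrees-nonadjacent v (λ ())
        (part-in-subtree (false , refl) f₀≢fv fx≡f₀)
        (part-in-subtree (true , refl) f₁≢fv fy≡f₁) x~y

    some-child-in-part : TwoCompressing f → ∀ v p → ∃ λ b → f (child b v p) ≡ f v
    some-child-in-part compressing v p with f (child false v p) ≟ f v | f (child true v p) ≟ f v
    ... | yes f₀≡fv | _         = false , f₀≡fv
    ... | no _      | yes f₁≡fv = true , f₁≡fv
    ... | no f₀≢fv  | no f₁≢fv  = ⊥-elim (children-not-both-split-off compressing v p f₀≢fv f₁≢fv)

    root-part-reaches-depth : TwoCompressing f → ∀ m → m ≤ suc d →
      ∃ λ v → depth v ≡ m × f v ≡ f root
    root-part-reaches-depth compressing zero _ = root , refl , refl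
    root-part-reaches-depth compressing (suc m) m<1+d
      with root-part-reaches-depth compressing m (≤-trans (n≤1+n m) m<1+d)
    ... | v , refl , fv≡fr with some-child-in-part compressing v m<1+d
    ... | b , fc≡fv = child b v m<1+d , refl , trans fc≡fv fv≡fr

proposition5 : (d : ℕ) (f : BVertex d → ℕ) →
    ¬ (ConnectedPartition f × WeakDiamLe f d × TwoCompressing f)
proposition5 d f (connected , diam≤d , compressing)
  with root-part-reaches-depth connected compressing (suc d) ≤-refl
... | leaf , depth≡1+d , fl≡fr with diam≤d root leaf (sym fl≡fr)
... | n , n≤d , walk = 1+n≰n (begin
  suc d       ≡⟨ sym depth≡1+d ⟩
  depth leaf  ≤⟨ Walk-depth walk ⟩
  n + 0       ≡⟨ +-identityʳ n ⟩
  n           ≤⟨ n≤d ⟩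
  d           ∎)
  where open ≤-Reasoning
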